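{- Let $T$ be a weighted star (a star $K_{1,n}$ with nonzero real weights on its edges). Then the group inverse graph $T^{\#}$ is isomorphic to $T$.
   Context: For a weighted graph with adjacency matrix $A$ (entry $(i,j)$ equal to the weight of edge $v_iv_j$, or $0$ if there is no such edge), the group inverse $A^{\#}$ is the unique matrix $X$ with $AXA=A$, $XAX=X$, $AX=XA$. The group inverse graph $T^{\#}$ has the same vertex set, with $v_iv_j$ an edge iff the $(i,j)$ entry of $A^{\#}$ is nonzero, weighted by that entry. Two weighted graphs are called isomorphic if their underlying (unweighted) graphs are isomorphic. -}

module Defs where

open import Level using (Level; _⊔_) renaming (suc to lsuc)
open import Data.Nat using (ℕ; zero; suc)
open import Data.Fin using (Fin; zero; suc)
open import Data.Product using (Σ; ∃; _×_; _,_)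
open import Data.Sum using (_⊎_)
open import Relation.Nullary using (¬_)
open import Relation.Binary using (Rel; IsStrictTotalOrder)
open import Relation.Unary using (Pred)
open import Function.Bundles using (_↔_; Inverse)
open import Algebra.Bundles using (CommutativeRing)

-- The real numbers, axiomatised as a complete ordered field
-- (stdlib has no reals).  Any model of this record is isomorphic to ℝ.
record RealField c ℓ : Set (lsuc (c ⊔ ℓ)) where
  field
    commRing : CommutativeRing c ℓ
  open CommutativeRing commRing public
  field
    _<_           : Rel Carrier ℓ
    nontrivial    : ¬ (1# ≈ 0#)
    inverse       : ∀ x → ¬ (x ≈ 0#) → Σ Carrier λ y → (x * y) ≈ 1#
    <-isStrictTotalOrder : IsStrictTotalOrder _≈_ _<_
    +-mono-<      : ∀ {x y} z → x < y → (x + z) < (y + z)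
    *-pos         : ∀ {x y} → 0# < x → 0# < y → 0# < (x * y)
  _≤_ : Rel Carrier ℓ
  x ≤ y = (x < y) ⊎ (x ≈ y)
  field
    complete : (P : Pred Carrier ℓ) → Σ Carrier P →
               Σ Carrier (λ b → ∀ x → P x → x ≤ b) →
               Σ Carrier λ s → (∀ x → P x → x ≤ s) ×
                               (∀ b → (∀ x → P x → x ≤ b) → s ≤ b)

module _ {c ℓ} (ℝ : RealField c ℓ) where
  open RealField ℝ using (Carrier; _≈_; _+_; _*_; 0#)

  Mat : ℕ → Set c
  Mat m = Fin m → Fin m → Carrier

  ∑ : ∀ {m} → (Fin m → Carrier) → Carrier
  ∑ {zero}  f = 0#
  ∑ {suc m} f = f zero + ∑ (λ i → f (suc i))

  _⊗_ : ∀ {m} → Mat m → Mat m → Mat m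
  (A ⊗ B) i j = ∑ (λ k → A i k * B k j)

  _≋_ : ∀ {m} → Mat m → Mat m → Set ℓ
  A ≋ B = ∀ i j → A i j ≈ B i j

  IsGroupInverse : ∀ {m} → Mat m → Mat m → Set ℓ
  IsGroupInverse A X = ((A ⊗ X) ⊗ A) ≋ A × ((X ⊗ A) ⊗ X) ≋ X × (A ⊗ X) ≋ (X ⊗ A)

  -- the weighted graph with adjacency matrix A has edge v_i v_j iff A i j ≠ 0
  Edge : ∀ {m} → Mat m → Fin m → Fin m → Set ℓ
  Edge A i j = ¬ (A i j ≈ 0#)

  GraphIso : ∀ {m} → Mat m → Mat m → Set ℓ
  GraphIso {m} A B = Σ (Fin m ↔ Fin m) λ σ →
    ∀ i j → (Edge A i j → Edge B (Inverse.to σ i) (Inverse.to σ j)) ×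
            (Edge B (Inverse.to σ i) (Inverse.to σ j) → Edge A i j)

  -- adjacency matrix of the weighted star K_{1,n}: centre = vertex zero,
  -- leaf suc i joined to the centre by an edge of weight w i
  star : ∀ {n} → (Fin n → Carrier) → Mat (suc n)
  star w zero    zero    = 0#
  star w zero    (suc j) = w j
  star w (suc i) zero    = w i
  star w (suc i) (suc j) = 0#

{-# OPTIONS --safe #-}
-- A³ = s A for the star A with weights w, where s = ∑ wᵢ².  For n ≥ 1 the
-- scalar s is positive, so s⁻¹ A is a group inverse of A; for n = 0 the
-- matrix A is zero and A itself is one.  Group inverses are unique, so every
-- group inverse is a nonzero multiple of A and has exactly the edges of A:
-- the identity permutation is the isomorphism.
module Submission where

open import Defs
open import Data.Nat using (ℕ; zero; suc)
open import Data.Fin using (Fin; zero; suc)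
open import Data.Product using (Σ; _×_; _,_; proj₁; proj₂)
open import Data.Empty using (⊥-elim)
open import Relation.Nullary using (¬_)
open import Function.Construct.Identity using (↔-id)
open import Relation.Binary using (Setoid; IsStrictTotalOrder; tri<; tri≈; tri>)
open import Relation.Binary.PropositionalEquality as ≡ using (_≡_)
import Relation.Binary.Reasoning.Setoid as SetoidReasoning
import Algebra.Properties.Ring as RingProperties
import Algebra.Properties.Semiring.Sum as SemiringSum
import Algebra.Properties.CommutativeSemigroup as CommSemigroupProperties

module _ {c ℓ} (ℝ : RealField c ℓ) where
  open RealField ℝ hiding (zero)
  open SemiringSum semiring
    using (sum; sum-cong-≋; sum-replicate-zero; *-distribˡ-sum; *-distribʳ-sum; ∑-comm)

  ∑≡sum : ∀ {m} (f : Fin m → Carrier) → ∑ ℝ f ≡ sum f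
  ∑≡sum {zero}  f = ≡.refl
  ∑≡sum {suc m} f = ≡.cong (f zero +_) (∑≡sum (λ i → f (suc i)))

  sum-zero : ∀ {m} {f : Fin m → Carrier} → (∀ i → f i ≈ 0#) → sum f ≈ 0#
  sum-zero {m} f≈0 = trans (sum-cong-≋ f≈0) (sum-replicate-zero m)

  private
    infixl 7 _⊗ₘ_
    _⊗ₘ_ : ∀ {m} → Mat ℝ m → Mat ℝ m → Mat ℝ m
    _⊗ₘ_ = _⊗_ ℝ

    infix 4 _≋ₘ_
    _≋ₘ_ : ∀ {m} → Mat ℝ m → Mat ℝ m → Set ℓ
    _≋ₘ_ = _≋_ ℝ

  ⊗-entry : ∀ {m} (A B : Mat ℝ m) i j → (A ⊗ₘ B) i j ≈ sum (λ k → A i k * B k j)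
  ⊗-entry A B i j = reflexive (∑≡sum (λ k → A i k * B k j))

  Mat-setoid : ℕ → Setoid c ℓ
  Mat-setoid m = record
    { Carrier       = Mat ℝ m
    ; _≈_           = _≋ₘ_
    ; isEquivalence = record
      { refl  = λ i j → refl
      ; sym   = λ A≋B i j → sym (A≋B i j)
      ; trans = λ A≋B B≋C i j → trans (A≋B i j) (B≋C i j)
      }
    }

  ≋ₘ-refl : ∀ {m} {A : Mat ℝ m} → A ≋ₘ A
  ≋ₘ-refl = Setoid.refl (Mat-setoid _)

  ⊗-cong : ∀ {m} {A A′ B B′ : Mat ℝ m} → A ≋ₘ A′ → B ≋ₘ B′ → A ⊗ₘ B ≋ₘ A′ ⊗ₘ B′
  ⊗-cong {A = A} {A′} {B} {B′} A≋A′ B≋B′ i j = begin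
    (A ⊗ₘ B) i j                      ≈⟨ ⊗-entry A B i j ⟩
    sum (λ k → A i k * B k j)         ≈⟨ sum-cong-≋ (λ k → *-cong (A≋A′ i k) (B≋B′ k j)) ⟩
    sum (λ k → A′ i k * B′ k j)       ≈⟨ ⊗-entry A′ B′ i j ⟨
    (A′ ⊗ₘ B′) i j                    ∎
    where open SetoidReasoning setoid

  ⊗-assoc : ∀ {m} (A B C : Mat ℝ m) → (A ⊗ₘ B) ⊗ₘ C ≋ₘ A ⊗ₘ (B ⊗ₘ C)
  ⊗-assoc A B C i j = begin
    ((A ⊗ₘ B) ⊗ₘ C) i j
      ≈⟨ ⊗-entry (A ⊗ₘ B) C i j ⟩
    sum (λ k → (A ⊗ₘ B) i k * C k j)
      ≈⟨ sum-cong-≋ (λ k → trans (*-congʳ (⊗-entry A B i k)) (*-distribʳ-sum (C k j) (λ l → A i l * B l k))) ⟩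
    sum (λ k → sum (λ l → A i l * B l k * C k j))
      ≈⟨ ∑-comm (λ k l → A i l * B l k * C k j) ⟩
    sum (λ l → sum (λ k → A i l * B l k * C k j))
      ≈⟨ sum-cong-≋ (λ l → sum-cong-≋ (λ k → *-assoc (A i l) (B l k) (C k j))) ⟩
    sum (λ l → sum (λ k → A i l * (B l k * C k j)))
      ≈⟨ sum-cong-≋ (λ l → trans (*-congˡ (⊗-entry B C l j)) (*-distribˡ-sum (A i l) (λ k → B l k * C k j))) ⟨
    sum (λ l → A i l * (B ⊗ₘ C) l j)
      ≈⟨ ⊗-entry A (B ⊗ₘ C) i j ⟨
    (A ⊗ₘ (B ⊗ₘ C)) i j ∎
    where open SetoidReasoning setoid

  groupInverse-unique : ∀ {m} {A X Y : Mat ℝ m} →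
    IsGroupInverse ℝ A X → IsGroupInverse ℝ A Y → X ≋ₘ Y
  groupInverse-unique {m} {A} {X} {Y} (AXA≋A , XAX≋X , AX≋XA) (AYA≋A , YAY≋Y , AY≋YA) =
    begin
      X               ≈⟨ XAX≋X ⟨
      X ⊗ₘ A ⊗ₘ X     ≈⟨ ⊗-cong XA≋YA ≋ₘ-refl ⟩
      Y ⊗ₘ A ⊗ₘ X     ≈⟨ ⊗-assoc Y A X ⟩
      Y ⊗ₘ (A ⊗ₘ X)   ≈⟨ ⊗-cong ≋ₘ-refl AX≋AY ⟩
      Y ⊗ₘ (A ⊗ₘ Y)   ≈⟨ ⊗-assoc Y A Y ⟨
      Y ⊗ₘ A ⊗ₘ Y     ≈⟨ YAY≋Y ⟩
      Y               ∎
    where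
    open SetoidReasoning (Mat-setoid m)

    AX≋AY : A ⊗ₘ X ≋ₘ A ⊗ₘ Y
    AX≋AY = begin
      A ⊗ₘ X              ≈⟨ ⊗-cong AYA≋A ≋ₘ-refl ⟨
      A ⊗ₘ Y ⊗ₘ A ⊗ₘ X    ≈⟨ ⊗-assoc (A ⊗ₘ Y) A X ⟩
      A ⊗ₘ Y ⊗ₘ (A ⊗ₘ X)  ≈⟨ ⊗-cong AY≋YA AX≋XA ⟩
      Y ⊗ₘ A ⊗ₘ (X ⊗ₘ A)  ≈⟨ ⊗-assoc Y A (X ⊗ₘ A) ⟩
      Y ⊗ₘ (A ⊗ₘ (X ⊗ₘ A)) ≈⟨ ⊗-cong ≋ₘ-refl (⊗-assoc A X A) ⟨
      Y ⊗ₘ (A ⊗ₘ X ⊗ₘ A)  ≈⟨ ⊗-cong ≋ₘ-refl AXA≋A ⟩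
      Y ⊗ₘ A              ≈⟨ AY≋YA ⟨
      A ⊗ₘ Y              ∎

    XA≋YA : X ⊗ₘ A ≋ₘ Y ⊗ₘ A
    XA≋YA = begin
      X ⊗ₘ A  ≈⟨ AX≋XA ⟨
      A ⊗ₘ X  ≈⟨ AX≋AY ⟩
      A ⊗ₘ Y  ≈⟨ AY≋YA ⟩
      Y ⊗ₘ A  ∎

  infixr 8 _·_
  _·_ : ∀ {m} → Carrier → Mat ℝ m → Mat ℝ m
  (x · A) i j = x * A i j

  ·-congʳ : ∀ {m} x {A B : Mat ℝ m} → A ≋ₘ B → x · A ≋ₘ x · B
  ·-congʳ x A≋B i j = *-congˡ (A≋B i j)

  ·-⊗ : ∀ {m} x (A B : Mat ℝ m) → (x · A) ⊗ₘ B ≋ₘ x · (A ⊗ₘ B)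
  ·-⊗ x A B i j = begin
    ((x · A) ⊗ₘ B) i j              ≈⟨ ⊗-entry (x · A) B i j ⟩
    sum (λ k → x * A i k * B k j)   ≈⟨ sum-cong-≋ (λ k → *-assoc x (A i k) (B k j)) ⟩
    sum (λ k → x * (A i k * B k j)) ≈⟨ *-distribˡ-sum x (λ k → A i k * B k j) ⟨
    x * sum (λ k → A i k * B k j)   ≈⟨ *-congˡ (⊗-entry A B i j) ⟨
    x * (A ⊗ₘ B) i j                ∎
    where open SetoidReasoning setoid

  ⊗-· : ∀ {m} x (A B : Mat ℝ m) → A ⊗ₘ (x · B) ≋ₘ x · (A ⊗ₘ B)
  ⊗-· x A B i j = begin
    (A ⊗ₘ (x · B)) i j              ≈⟨ ⊗-entry A (x · B) i j ⟩
    sum (λ k → A i k * (x * B k j)) ≈⟨ sum-cong-≋ (λ k → x∙yz≈y∙xz (A i k) x (B k j)) ⟩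
    sum (λ k → x * (A i k * B k j)) ≈⟨ *-distribˡ-sum x (λ k → A i k * B k j) ⟨
    x * sum (λ k → A i k * B k j)   ≈⟨ *-congˡ (⊗-entry A B i j) ⟨
    x * (A ⊗ₘ B) i j                ∎
    where
    open SetoidReasoning setoid
    open CommSemigroupProperties *-commutativeSemigroup using (x∙yz≈y∙xz)

  ·-·-inverse : ∀ {m} {s t} → s * t ≈ 1# → (A : Mat ℝ m) → t · s · A ≋ₘ A
  ·-·-inverse {s = s} {t} st≈1 A i j = begin
    t * (s * A i j)  ≈⟨ *-assoc t s (A i j) ⟨
    t * s * A i j    ≈⟨ *-congʳ (trans (*-comm t s) st≈1) ⟩
    1# * A i j       ≈⟨ *-identityˡ (A i j) ⟩
    A i j            ∎
    where open SetoidReasoning setoid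

  scaled-groupInverse : ∀ {m} {A : Mat ℝ m} {s t} → s * t ≈ 1# →
    A ⊗ₘ A ⊗ₘ A ≋ₘ s · A → IsGroupInverse ℝ A (t · A)
  scaled-groupInverse {m} {A} {s} {t} st≈1 A³≋sA =
    (begin
      A ⊗ₘ (t · A) ⊗ₘ A    ≈⟨ ⊗-cong (⊗-· t A A) ≋ₘ-refl ⟩
      t · (A ⊗ₘ A) ⊗ₘ A    ≈⟨ t·A³≋A ⟩
      A                    ∎) ,
    (begin
      (t · A) ⊗ₘ A ⊗ₘ (t · A)  ≈⟨ ⊗-· t ((t · A) ⊗ₘ A) A ⟩
      t · ((t · A) ⊗ₘ A ⊗ₘ A)  ≈⟨ ·-congʳ t (⊗-cong (·-⊗ t A A) ≋ₘ-refl) ⟩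
      t · (t · (A ⊗ₘ A) ⊗ₘ A)  ≈⟨ ·-congʳ t t·A³≋A ⟩
      t · A                    ∎) ,
    (begin
      A ⊗ₘ (t · A)  ≈⟨ ⊗-· t A A ⟩
      t · (A ⊗ₘ A)  ≈⟨ ·-⊗ t A A ⟨
      (t · A) ⊗ₘ A  ∎)
    where
    open SetoidReasoning (Mat-setoid m)

    t·A³≋A : t · (A ⊗ₘ A) ⊗ₘ A ≋ₘ A
    t·A³≋A = begin
      t · (A ⊗ₘ A) ⊗ₘ A  ≈⟨ ·-⊗ t (A ⊗ₘ A) A ⟩
      t · (A ⊗ₘ A ⊗ₘ A)  ≈⟨ ·-congʳ t A³≋sA ⟩
      t · s · A          ≈⟨ ·-·-inverse st≈1 A ⟩
      A                  ∎

  ≋-unit-scaled⇒GraphIso : ∀ {m} {A X : Mat ℝ m} {s t} → s * t ≈ 1# →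
    X ≋ₘ t · A → GraphIso ℝ A X
  ≋-unit-scaled⇒GraphIso {m} {A} {X} {s} {t} st≈1 X≋tA = ↔-id (Fin m) , λ i j →
    (λ Aij≉0 Xij≈0 → Aij≉0 (begin
      A i j            ≈⟨ ·-·-inverse (trans (*-comm t s) st≈1) A i j ⟨
      s * (t * A i j)  ≈⟨ *-congˡ (X≋tA i j) ⟨
      s * X i j        ≈⟨ *-congˡ Xij≈0 ⟩
      s * 0#           ≈⟨ zeroʳ s ⟩
      0#               ∎)) ,
    (λ Xij≉0 Aij≈0 → Xij≉0 (begin
      X i j            ≈⟨ X≋tA i j ⟩
      t * A i j        ≈⟨ *-congˡ Aij≈0 ⟩
      t * 0#           ≈⟨ zeroʳ t ⟩
      0#               ∎))
    where open SetoidReasoning setoid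

  module _ where
    open IsStrictTotalOrder <-isStrictTotalOrder
      using (compare; irrefl; <-respˡ-≈; <-respʳ-≈) renaming (trans to <-trans)
    open RingProperties ring using (-‿distribˡ-*; -‿distribʳ-*; -‿involutive)

    positive⇒≉0 : ∀ {x} → 0# < x → ¬ (x ≈ 0#)
    positive⇒≉0 0<x x≈0 = irrefl (sym x≈0) 0<x

    +-positive : ∀ {x y} → 0# < x → 0# < y → 0# < (x + y)
    +-positive {x} {y} 0<x 0<y =
      <-trans (<-respʳ-≈ (sym (+-identityˡ y)) 0<y) (+-mono-< y 0<x)

    negative⇒-positive : ∀ {x} → x < 0# → 0# < (- x)
    negative⇒-positive {x} x<0 =
      <-respˡ-≈ (-‿inverseʳ x) (<-respʳ-≈ (+-identityˡ (- x)) (+-mono-< (- x) x<0))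

    -x*-x≈x*x : ∀ x → - x * - x ≈ x * x
    -x*-x≈x*x x = begin
      - x * - x      ≈⟨ -‿distribˡ-* x (- x) ⟨
      - (x * - x)    ≈⟨ -‿cong (-‿distribʳ-* x x) ⟨
      - (- (x * x))  ≈⟨ -‿involutive (x * x) ⟩
      x * x          ∎
      where open SetoidReasoning setoid

    square-positive : ∀ {x} → ¬ (x ≈ 0#) → 0# < (x * x)
    square-positive {x} x≉0 with compare x 0#
    ... | tri< x<0 _ _ = <-respʳ-≈ (-x*-x≈x*x x) (*-pos 0<-x 0<-x)
      where 0<-x = negative⇒-positive x<0
    ... | tri≈ _ x≈0 _ = ⊥-elim (x≉0 x≈0)
    ... | tri> _ _ 0<x = *-pos 0<x 0<x

    sum-positive : ∀ {m} (f : Fin (suc m) → Carrier) → (∀ i → 0# < f i) → 0# < sum f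
    sum-positive {zero}  f 0<f = <-respʳ-≈ (sym (+-identityʳ (f zero))) (0<f zero)
    sum-positive {suc m} f 0<f =
      +-positive (0<f zero) (sum-positive (λ i → f (suc i)) (λ i → 0<f (suc i)))

  module _ {n} (w : Fin n → Carrier) where
    private
      A : Mat ℝ (suc n)
      A = star ℝ w

    sumOfSquares : Carrier
    sumOfSquares = sum (λ k → w k * w k)

    starSquare : Mat ℝ (suc n)
    starSquare zero    zero    = sumOfSquares
    starSquare zero    (suc j) = 0#
    starSquare (suc i) zero    = 0#
    starSquare (suc i) (suc j) = w i * w j

    star-square : A ⊗ₘ A ≋ₘ starSquare
    star-square zero zero = trans (⊗-entry A A zero zero)
      (trans (+-congʳ (zeroˡ 0#)) (+-identityˡ sumOfSquares))
    star-square zero (suc j) = trans (⊗-entry A A zero (suc j))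
      (trans (+-cong (zeroˡ (w j)) (sum-zero (λ k → zeroʳ (w k)))) (+-identityˡ 0#))
    star-square (suc i) zero = trans (⊗-entry A A (suc i) zero)
      (trans (+-cong (zeroʳ (w i)) (sum-zero (λ k → zeroˡ (w k)))) (+-identityˡ 0#))
    star-square (suc i) (suc j) = trans (⊗-entry A A (suc i) (suc j))
      (trans (+-congˡ (sum-zero {n} (λ _ → zeroˡ 0#))) (+-identityʳ (w i * w j)))

    starSquare-⊗-star : starSquare ⊗ₘ A ≋ₘ sumOfSquares · A
    starSquare-⊗-star zero zero = trans (⊗-entry starSquare A zero zero)
      (trans (+-congˡ (sum-zero (λ k → zeroˡ (w k)))) (+-identityʳ _))
    starSquare-⊗-star zero (suc j) = trans (⊗-entry starSquare A zero (suc j))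
      (trans (+-congˡ (sum-zero {n} (λ _ → zeroˡ 0#))) (+-identityʳ _))
    starSquare-⊗-star (suc i) zero = begin
      (starSquare ⊗ₘ A) (suc i) zero
        ≈⟨ ⊗-entry starSquare A (suc i) zero ⟩
      0# * 0# + sum (λ k → w i * w k * w k)
        ≈⟨ +-cong (zeroˡ 0#) (sum-cong-≋ (λ k → *-assoc (w i) (w k) (w k))) ⟩
      0# + sum (λ k → w i * (w k * w k))
        ≈⟨ +-identityˡ _ ⟩
      sum (λ k → w i * (w k * w k))
        ≈⟨ *-distribˡ-sum (w i) (λ k → w k * w k) ⟨
      w i * sumOfSquares
        ≈⟨ *-comm (w i) sumOfSquares ⟩
      sumOfSquares * w i ∎
      where open SetoidReasoning setoid
    starSquare-⊗-star (suc i) (suc j) = trans (⊗-entry starSquare A (suc i) (suc j))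
      (trans (+-cong (zeroˡ (w j)) (sum-zero (λ k → zeroʳ (w i * w k))))
        (trans (+-identityˡ 0#) (sym (zeroʳ sumOfSquares))))

    star-cube : A ⊗ₘ A ⊗ₘ A ≋ₘ sumOfSquares · A
    star-cube i j = trans (⊗-cong star-square (≋ₘ-refl {A = A}) i j) (starSquare-⊗-star i j)

  star-cube-unitMultiple : ∀ {n} (w : Fin n → Carrier) → (∀ i → ¬ (w i ≈ 0#)) →
    Σ Carrier λ s → Σ Carrier λ t → s * t ≈ 1# × star ℝ w ⊗ₘ star ℝ w ⊗ₘ star ℝ w ≋ₘ s · star ℝ w
  star-cube-unitMultiple {zero} w _ = 1# , 1# , *-identityˡ 1# , A³≋1·A
    where
    A³≋1·A : star ℝ w ⊗ₘ star ℝ w ⊗ₘ star ℝ w ≋ₘ 1# · star ℝ w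
    A³≋1·A zero zero = trans (star-cube w zero zero) (trans (zeroˡ 0#) (sym (zeroʳ 1#)))
  star-cube-unitMultiple {suc m} w w≉0 =
    sumOfSquares w , proj₁ (inverse _ s≉0) , proj₂ (inverse _ s≉0) , star-cube w
    where
    s≉0 : ¬ (sumOfSquares w ≈ 0#)
    s≉0 = positive⇒≉0 (sum-positive (λ k → w k * w k) (λ k → square-positive (w≉0 k)))

  star-groupInverse-unitMultiple : ∀ {n} (w : Fin n → Carrier) → (∀ i → ¬ (w i ≈ 0#)) →
    Σ Carrier λ s → Σ Carrier λ t → s * t ≈ 1# × IsGroupInverse ℝ (star ℝ w) (t · star ℝ w)
  star-groupInverse-unitMultiple w w≉0 with star-cube-unitMultiple w w≉0
  ... | s , t , st≈1 , A³≋sA = s , t , st≈1 , scaled-groupInverse st≈1 A³≋sA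

corollary2p3 : ∀ {c ℓ} (ℝ : RealField c ℓ) (n : ℕ) (w : Fin n → RealField.Carrier ℝ) →
    (∀ i → ¬ (RealField._≈_ ℝ (w i) (RealField.0# ℝ))) →
    Σ (Mat ℝ (suc n)) (IsGroupInverse ℝ (star ℝ w)) ×
    (∀ X → IsGroupInverse ℝ (star ℝ w) X → GraphIso ℝ (star ℝ w) X)
corollary2p3 ℝ n w w≉0 with star-groupInverse-unitMultiple ℝ w w≉0
... | s , t , st≈1 , groupInverse =
  (_ , groupInverse) ,
  λ X X-groupInverse →
    ≋-unit-scaled⇒GraphIso ℝ st≈1 (groupInverse-unique ℝ X-groupInverse groupInverse)
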